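{- Let $r$ be a power of $2$ and let $G$ and $P$ be the graph and critical path set defined below. Then every critical path $\pi\in P$ is the unique path in $G$ between its start vertex and its end vertex.
   Context: For a nonnegative integer $N$, $\langle N\rangle=\{0,\dots,N-1\}$ and $[N]=\{1,\dots,N\}$. Let $r$ be a power of $2$ and let $q$ be the permutation of $\langle r\rangle$ such that the $(\log_2 r)$-bit binary representation of $q_i$ is the $(\log_2 r)$-bit binary representation of $i$ reversed. The directed graph $G$ has vertex set $\{(i,x_1,x_2): i\in\{0,\dots,r\},\ (x_1,x_2)\in\langle 2r\rangle\times\langle 2r^2\rangle\}$ ($i$ is the layer). For $i\in\langle r\rangle$ let $E_i=\{(1,q_i),(0,0)\}$; for every vertex $(i,x_1,x_2)$ with $i<r$ and every $(e_1,e_2)\in E_i$ with $(x_1+e_1,x_2+e_2)\in\langle 2r\rangle\times\langle 2r^2\rangle$ there is an edge from $(i,x_1,x_2)$ to $(i+1,x_1+e_1,x_2+e_2)$; there are no other edges. For each $(x_1,x_2)\in\langle r\rangle\times\langle r^2\rangle$ and each $s\in[r]$ there is a critical path: it starts at $(0,x_1,x_2)$ and, from layer $i$ to layer $i+1$ ($i=0,\dots,r-1$), uses the edge corresponding to $(1,q_i)$ if $q_i<s$ and the edge corresponding to $(0,0)$ otherwise. $P$ is the set of all these critical paths. -}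

module Defs where

open import Data.Nat using (ℕ; zero; suc; _+_; _*_; _^_; _≤_; _<_; _<ᵇ_)
open import Data.Nat.DivMod using (_/_; _%_)
open import Data.Product using (_×_; _,_)
open import Data.Sum using (_⊎_)
open import Data.Bool using (if_then_else_)
open import Data.List using (List; []; _∷_)
open import Relation.Binary.PropositionalEquality using (_≡_)

-- Throughout, r = 2 ^ k (so log₂ r = k).

bitrev : ℕ → ℕ → ℕ
bitrev zero    i = 0
bitrev (suc k) i = (i % 2) * 2 ^ k + bitrev k (i / 2)

q : ℕ → ℕ → ℕ
q k i = bitrev k i

V : Set
V = ℕ × ℕ × ℕ

IsVertex : ℕ → V → Set
IsVertex k (i , x₁ , x₂) = i ≤ 2 ^ k × x₁ < 2 * 2 ^ k × x₂ < 2 * (2 ^ k * 2 ^ k)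

Edge : ℕ → V → V → Set
Edge k (i , x₁ , x₂) (j , y₁ , y₂) =
  i < 2 ^ k × j ≡ suc i
  × IsVertex k (i , x₁ , x₂) × IsVertex k (j , y₁ , y₂)
  × ((y₁ ≡ x₁ + 1 × y₂ ≡ x₂ + q k i) ⊎ (y₁ ≡ x₁ + 0 × y₂ ≡ x₂ + 0))

data Path (k : ℕ) : V → V → List V → Set where
  single : ∀ {u} → IsVertex k u → Path k u u (u ∷ [])
  step   : ∀ {u w v vs} → Edge k u w → Path k w v vs → Path k u v (u ∷ vs)

critFrom : ℕ → ℕ → ℕ → ℕ → ℕ → ℕ → List V
critFrom k s zero    i x₁ x₂ = (i , x₁ , x₂) ∷ []
critFrom k s (suc n) i x₁ x₂ =
  (i , x₁ , x₂) ∷ (if q k i <ᵇ s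
                    then critFrom k s n (suc i) (x₁ + 1) (x₂ + q k i)
                    else critFrom k s n (suc i) (x₁ + 0) (x₂ + 0))

critEndFrom : ℕ → ℕ → ℕ → ℕ → ℕ → ℕ → V
critEndFrom k s zero    i x₁ x₂ = (i , x₁ , x₂)
critEndFrom k s (suc n) i x₁ x₂ =
  if q k i <ᵇ s
  then critEndFrom k s n (suc i) (x₁ + 1) (x₂ + q k i)
  else critEndFrom k s n (suc i) (x₁ + 0) (x₂ + 0)

critPath : ℕ → ℕ → ℕ → ℕ → List V
critPath k s x₁ x₂ = critFrom k s (2 ^ k) 0 x₁ x₂

critEnd : ℕ → ℕ → ℕ → ℕ → V
critEnd k s x₁ x₂ = critEndFrom k s (2 ^ k) 0 x₁ x₂

{-# OPTIONS --safe #-}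
module Submission where

open import Defs
open import Data.Nat using (ℕ; zero; suc; _+_; _*_; _^_; _≤_; _<_; _<ᵇ_; s≤s)
open import Data.Nat.Properties
open import Data.Nat.DivMod using (_/_; _%_; m%n<n)
open import Data.Nat.Tactic.RingSolver using (solve-∀)
open import Data.Bool using (Bool; true; false; if_then_else_; T)
open import Data.List using (List; []; _∷_; length)
open import Data.Product using (Σ-syntax; _×_; _,_; proj₁; proj₂)
open import Data.Sum using (_⊎_; inj₁; inj₂)
open import Data.Empty using (⊥-elim)
open import Data.Unit using (tt)
open import Function using (_∘_)
open import Relation.Binary.PropositionalEquality

-- A path of G from layer 0 to layer r is determined by the set S of layers at which it takes the
-- step (1 , q_i), and it ends at its start plus (r , |S| , Σ_{i ∈ S} q_i).  The critical path takes
-- S* = {i : q_i < s}.  Weigh layer i by 2 q_i + 1 − 2 s, which is never 0: S* is the set of layers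
-- of negative weight, hence the unique set of least total weight; as the total weight of S is a
-- function of |S| and Σ_{i ∈ S} q_i, a path with the endpoints of the critical one takes the
-- same steps.

bitrev-< : ∀ k i → bitrev k i < 2 ^ k
bitrev-< zero    i = ≤-refl
bitrev-< (suc k) i = begin-strict
  (i % 2) * 2 ^ k + bitrev k (i / 2) <⟨ +-mono-≤-< (*-monoˡ-≤ (2 ^ k) (<⇒≤pred (m%n<n i 2))) (bitrev-< k (i / 2)) ⟩
  1 * 2 ^ k + 2 ^ k                  ≡⟨ +-comm (1 * 2 ^ k) (2 ^ k) ⟩
  2 ^ suc k                          ∎
  where open ≤-Reasoning

-- A selection bs read from position i marks the positions i, i + 1, … whose entry is true.
selSum : (ℕ → ℕ) → ℕ → List Bool → ℕ
selSum f i []       = 0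
selSum f i (c ∷ bs) = (if c then f i else 0) + selSum f (suc i) bs

count : ℕ → List Bool → ℕ
count = selSum (λ _ → 1)

select : (ℕ → Bool) → ℕ → ℕ → List Bool
select p zero    i = []
select p (suc n) i = p i ∷ select p n (suc i)

selSum-linear : ∀ m f g i bs →
  selSum (λ j → m * f j + g j) i bs ≡ m * selSum f i bs + selSum g i bs
selSum-linear m f g i []          = sym (cong (_+ 0) (*-zeroʳ m))
selSum-linear m f g i (false ∷ bs) = selSum-linear m f g (suc i) bs
selSum-linear m f g i (true ∷ bs)  = begin
  (m * f i + g i) + selSum (λ j → m * f j + g j) (suc i) bs
    ≡⟨ cong ((m * f i + g i) +_) (selSum-linear m f g (suc i) bs) ⟩
  (m * f i + g i) + (m * selSum f (suc i) bs + selSum g (suc i) bs)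
    ≡⟨ regroup m (f i) (g i) (selSum f (suc i) bs) (selSum g (suc i) bs) ⟩
  m * (f i + selSum f (suc i) bs) + (g i + selSum g (suc i) bs) ∎
  where
  open ≡-Reasoning
  regroup : ∀ m x y X Y → (m * x + y) + (m * X + Y) ≡ m * (x + X) + (y + Y)
  regroup = solve-∀

module Threshold (w : ℕ → ℕ) (t : ℕ) (p : ℕ → Bool)
                 (below : ∀ j → p j ≡ true → w j < t)
                 (above : ∀ j → p j ≡ false → t < w j) where

  -- Cost i as bs < Cost i bs as says Σ_{j ∈ as} (w j − t) < Σ_{j ∈ bs} (w j − t), with both sides
  -- moved so that no subtraction occurs.
  Cost : ℕ → List Bool → List Bool → ℕ
  Cost i as bs = selSum w i as + t * count i bs

  Cheaper : ℕ → List Bool → List Bool → Set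
  Cheaper i as bs = Cost i as bs < Cost i bs as

  private
    Cost₁ : ℕ → Bool → Bool → ℕ
    Cost₁ i a b = (if a then w i else 0) + t * (if b then 1 else 0)

    Cost-∷ : ∀ i a b as bs → Cost i (a ∷ as) (b ∷ bs) ≡ Cost (suc i) as bs + Cost₁ i a b
    Cost-∷ i a b as bs = regroup t (if a then w i else 0) (selSum w (suc i) as)
                                   (if b then 1 else 0) (count (suc i) bs)
      where
      regroup : ∀ t x X y Y → (x + X) + t * (y + Y) ≡ (X + t * Y) + (x + t * y)
      regroup = solve-∀

    Cost₁-true-false : ∀ i → Cost₁ i true false ≡ w i
    Cost₁-true-false i = trans (cong (w i +_) (*-zeroʳ t)) (+-identityʳ (w i))

    Cost₁-false-true : ∀ i → Cost₁ i false true ≡ t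
    Cost₁-false-true i = *-identityʳ t

    cheaper-∷ : ∀ {i} a b as bs →
      Cost (suc i) as bs + Cost₁ i a b < Cost (suc i) bs as + Cost₁ i b a → Cheaper i (a ∷ as) (b ∷ bs)
    cheaper-∷ {i} a b as bs = subst₂ _<_ (sym (Cost-∷ i a b as bs)) (sym (Cost-∷ i b a bs as))

    cost-≤ : ∀ {i as bs} → bs ≡ as ⊎ Cheaper i as bs → Cost i as bs ≤ Cost i bs as
    cost-≤ (inj₁ refl) = ≤-refl
    cost-≤ (inj₂ lt)   = <⇒≤ lt

    cheapest-∷ : ∀ i a b as bs → p i ≡ a → bs ≡ as ⊎ Cheaper (suc i) as bs →
                 b ∷ bs ≡ a ∷ as ⊎ Cheaper i (a ∷ as) (b ∷ bs)
    cheapest-∷ i true  true  as bs _  (inj₁ same) = inj₁ (cong (true ∷_) same)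
    cheapest-∷ i false false as bs _  (inj₁ same) = inj₁ (cong (false ∷_) same)
    cheapest-∷ i true  true  as bs _  (inj₂ tail) = inj₂ (cheaper-∷ true true as bs (+-monoˡ-< _ tail))
    cheapest-∷ i false false as bs _  (inj₂ tail) = inj₂ (cheaper-∷ false false as bs (+-monoˡ-< _ tail))
    cheapest-∷ i true  false as bs pᵢ tail = inj₂ (cheaper-∷ true false as bs (+-mono-≤-< (cost-≤ tail)
      (subst₂ _<_ (sym (Cost₁-true-false i)) (sym (Cost₁-false-true i)) (below i pᵢ))))
    cheapest-∷ i false true  as bs pᵢ tail = inj₂ (cheaper-∷ false true as bs (+-mono-≤-< (cost-≤ tail)
      (subst₂ _<_ (sym (Cost₁-false-true i)) (sym (Cost₁-true-false i)) (above i pᵢ))))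

  select-cheapest : ∀ i bs → bs ≡ select p (length bs) i ⊎ Cheaper i (select p (length bs) i) bs
  select-cheapest i []       = inj₁ refl
  select-cheapest i (b ∷ bs) =
    cheapest-∷ i (p i) b (select p (length bs) (suc i)) bs refl (select-cheapest (suc i) bs)

  select-unique : ∀ i n bs → length bs ≡ n →
    count i bs ≡ count i (select p n i) →
    selSum w i bs ≡ selSum w i (select p n i) →
    bs ≡ select p n i
  select-unique i _ bs refl same-count same-weight with select-cheapest i bs
  ... | inj₁ selected = selected
  ... | inj₂ cheaper  =
    ⊥-elim (<-irrefl (cong₂ (λ W C → W + t * C) (sym same-weight) same-count) cheaper)

length-select : ∀ p n i → length (select p n i) ≡ n
length-select p zero    i = refl
length-select p (suc n) i = cong suc (length-select p n (suc i))

module _ (k : ℕ) where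

  walk : ℕ → ℕ → ℕ → List Bool → List V
  walk i a b []       = (i , a , b) ∷ []
  walk i a b (c ∷ bs) = (i , a , b) ∷ (if c then walk (suc i) (a + 1) (b + q k i) bs
                                             else walk (suc i) (a + 0) (b + 0) bs)

  walkEnd : ℕ → ℕ → ℕ → List Bool → V
  walkEnd i a b []       = (i , a , b)
  walkEnd i a b (c ∷ bs) = if c then walkEnd (suc i) (a + 1) (b + q k i) bs
                                else walkEnd (suc i) (a + 0) (b + 0) bs

  walkEnd≡ : ∀ i a b bs → walkEnd i a b bs ≡ (length bs + i , a + count i bs , b + selSum (q k) i bs)
  walkEnd≡ i a b []           = cong₂ _,_ refl (cong₂ _,_ (sym (+-identityʳ a)) (sym (+-identityʳ b)))
  walkEnd≡ i a b (true ∷ bs)  = trans (walkEnd≡ (suc i) (a + 1) (b + q k i) bs)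
    (cong₂ _,_ (+-suc (length bs) i) (cong₂ _,_ (+-assoc a 1 _) (+-assoc b (q k i) _)))
  walkEnd≡ i a b (false ∷ bs) = trans (walkEnd≡ (suc i) (a + 0) (b + 0) bs)
    (cong₂ _,_ (+-suc (length bs) i) (cong₂ _,_ (cong (_+ _) (+-identityʳ a)) (cong (_+ _) (+-identityʳ b))))

  path⇒walk : ∀ {i a b v vs} → Path k (i , a , b) v vs → Σ[ bs ∈ List Bool ] vs ≡ walk i a b bs × v ≡ walkEnd i a b bs
  path⇒walk (single _) = [] , refl , refl
  path⇒walk (step (_ , refl , _ , _ , inj₁ (refl , refl)) p) with path⇒walk p
  ... | bs , refl , refl = true ∷ bs , refl , refl
  path⇒walk (step (_ , refl , _ , _ , inj₂ (refl , refl)) p) with path⇒walk p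
  ... | bs , refl , refl = false ∷ bs , refl , refl

  private
    r : ℕ
    r = 2 ^ k

  inRange⇒IsVertex : ∀ {i a b} → i ≤ r → a < i + r → b < r * (i + r) → IsVertex k (i , a , b)
  inRange⇒IsVertex i≤r a< b< =
      i≤r
    , <-≤-trans a< (≤-trans (+-monoˡ-≤ r i≤r) (≤-reflexive (cong (r +_) (sym (+-identityʳ r)))))
    , <-≤-trans b< (≤-trans (*-monoʳ-≤ r (+-monoˡ-≤ r i≤r)) (≤-reflexive (double r)))
    where
    double : ∀ r → r * (r + r) ≡ 2 * (r * r)
    double = solve-∀

  walk-path : ∀ i a b bs → length bs + i ≤ r → a < i + r → b < r * (i + r) →
              Path k (i , a , b) (walkEnd i a b bs) (walk i a b bs)
  walk-path i a b []           len a< b< = single (inRange⇒IsVertex len a< b<)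
  walk-path i a b (true ∷ bs)  len a< b< =
    step (i<r , refl , inRange⇒IsVertex (<⇒≤ i<r) a< b< , inRange⇒IsVertex i<r a<′ b<′ , inj₁ (refl , refl))
         (walk-path (suc i) (a + 1) (b + q k i) bs (subst (_≤ r) (sym (+-suc _ i)) len) a<′ b<′)
    where
    i<r : i < r
    i<r = ≤-trans (s≤s (m≤n+m i (length bs))) len
    a<′ : a + 1 < suc i + r
    a<′ = subst (_< suc i + r) (+-comm 1 a) (s≤s a<)
    b<′ : b + q k i < r * (suc i + r)
    b<′ = subst (b + q k i <_) (trans (+-comm _ r) (sym (*-suc r (i + r)))) (+-mono-< b< (bitrev-< k i))
  walk-path i a b (false ∷ bs) len a< b< =
    step (i<r , refl , inRange⇒IsVertex (<⇒≤ i<r) a< b< , inRange⇒IsVertex i<r a<′ b<′ , inj₂ (refl , refl))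
         (walk-path (suc i) (a + 0) (b + 0) bs (subst (_≤ r) (sym (+-suc _ i)) len) a<′ b<′)
    where
    i<r : i < r
    i<r = ≤-trans (s≤s (m≤n+m i (length bs))) len
    a<′ : a + 0 < suc i + r
    a<′ = subst (_< suc i + r) (sym (+-identityʳ a)) (m<n⇒m<1+n a<)
    b<′ : b + 0 < r * (suc i + r)
    b<′ = subst (_< r * (suc i + r)) (sym (+-identityʳ b)) (<-≤-trans b< (*-monoʳ-≤ r (n≤1+n (i + r))))

  critical : ℕ → ℕ → Bool
  critical s j = q k j <ᵇ s

  critFrom≡walk : ∀ s n i a b → critFrom k s n i a b ≡ walk i a b (select (critical s) n i)
  critFrom≡walk s zero    i a b = refl
  critFrom≡walk s (suc n) i a b with critical s i
  ... | true  = cong (_ ∷_) (critFrom≡walk s n (suc i) (a + 1) (b + q k i))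
  ... | false = cong (_ ∷_) (critFrom≡walk s n (suc i) (a + 0) (b + 0))

  critEndFrom≡walkEnd : ∀ s n i a b → critEndFrom k s n i a b ≡ walkEnd i a b (select (critical s) n i)
  critEndFrom≡walkEnd s zero    i a b = refl
  critEndFrom≡walkEnd s (suc n) i a b with critical s i
  ... | true  = critEndFrom≡walkEnd s n (suc i) (a + 1) (b + q k i)
  ... | false = critEndFrom≡walkEnd s n (suc i) (a + 0) (b + 0)

  -- Doubling and adding 1 makes the weights odd, so no weight equals the threshold 2 s.
  critical-below : ∀ s j → critical s j ≡ true → 2 * q k j + 1 < 2 * s
  critical-below s j crit = subst (_≤ 2 * s) (trans (*-suc 2 (q k j)) (cong suc (+-comm 1 (2 * q k j))))
                                  (*-monoʳ-≤ 2 (<ᵇ⇒< (q k j) s (subst T (sym crit) tt)))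

  critical-above : ∀ s j → critical s j ≡ false → 2 * s < 2 * q k j + 1
  critical-above s j crit = subst (2 * s <_) (+-comm 1 (2 * q k j))
                                  (s≤s (*-monoʳ-≤ 2 (≮⇒≥ {q k j} {s} (λ q<s → subst T crit (<⇒<ᵇ q<s)))))

  critical-determined-by-end : ∀ s i a b n bs →
    walkEnd i a b bs ≡ walkEnd i a b (select (critical s) n i) → bs ≡ select (critical s) n i
  critical-determined-by-end s i a b n bs same-end =
    select-unique i n bs same-length same-count same-weight
    where
    open Threshold (λ j → 2 * q k j + 1) (2 * s) (critical s) (critical-below s) (critical-above s)
    sel = select (critical s) n i
    ends = trans (sym (walkEnd≡ i a b bs)) (trans same-end (walkEnd≡ i a b sel))
    same-length : length bs ≡ n
    same-length = trans (+-cancelʳ-≡ i _ _ (cong proj₁ ends)) (length-select (critical s) n i)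
    same-count : count i bs ≡ count i sel
    same-count = +-cancelˡ-≡ a _ _ (cong (proj₁ ∘ proj₂) ends)
    same-weight : selSum (λ j → 2 * q k j + 1) i bs ≡ selSum (λ j → 2 * q k j + 1) i sel
    same-weight = begin
      selSum (λ j → 2 * q k j + 1) i bs    ≡⟨ selSum-linear 2 (q k) (λ _ → 1) i bs ⟩
      2 * selSum (q k) i bs + count i bs    ≡⟨ cong₂ (λ Q C → 2 * Q + C)
                                                 (+-cancelˡ-≡ b _ _ (cong (proj₂ ∘ proj₂) ends)) same-count ⟩
      2 * selSum (q k) i sel + count i sel  ≡⟨ selSum-linear 2 (q k) (λ _ → 1) i sel ⟨
      selSum (λ j → 2 * q k j + 1) i sel   ∎
      where open ≡-Reasoning

lemma4p1 : (k x₁ x₂ s : ℕ) → x₁ < 2 ^ k → x₂ < 2 ^ k * 2 ^ k → 1 ≤ s → s ≤ 2 ^ k →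
    Path k (0 , x₁ , x₂) (critEnd k s x₁ x₂) (critPath k s x₁ x₂)
    × ((vs : List V) → Path k (0 , x₁ , x₂) (critEnd k s x₁ x₂) vs → vs ≡ critPath k s x₁ x₂)
lemma4p1 k x₁ x₂ s x₁<r x₂<r² _ _ = critical-path , unique
  where
  crit : List Bool
  crit = select (critical k s) (2 ^ k) 0
  critPath≡ : critPath k s x₁ x₂ ≡ walk k 0 x₁ x₂ crit
  critPath≡ = critFrom≡walk k s (2 ^ k) 0 x₁ x₂
  critEnd≡ : critEnd k s x₁ x₂ ≡ walkEnd k 0 x₁ x₂ crit
  critEnd≡ = critEndFrom≡walkEnd k s (2 ^ k) 0 x₁ x₂
  critical-path : Path k (0 , x₁ , x₂) (critEnd k s x₁ x₂) (critPath k s x₁ x₂)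
  critical-path = subst₂ (Path k _) (sym critEnd≡) (sym critPath≡)
    (walk-path k 0 x₁ x₂ crit (≤-reflexive (trans (+-identityʳ _) (length-select _ _ 0))) x₁<r x₂<r²)
  unique : (vs : List V) → Path k (0 , x₁ , x₂) (critEnd k s x₁ x₂) vs → vs ≡ critPath k s x₁ x₂
  unique vs p with path⇒walk k p
  ... | bs , refl , end = trans
    (cong (walk k 0 x₁ x₂) (critical-determined-by-end k s 0 x₁ x₂ (2 ^ k) bs (trans (sym end) critEnd≡)))
    (sym critPath≡)
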